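{- Let $q$ be a power of an odd prime, let $\lambda\in\mathbb{F}_q$ be a non-square, and let $S_\lambda=\{a\in\mathbb{F}_q:\ \mathcal{G}(\lambda,X+a)\text{ has a fixed vertex}\}$. Then $$|S_\lambda|=\frac14\big(3q+1+\chi(\lambda-1)-\chi(1-\lambda)\big),$$ where $\chi$ is the quadratic character of $\mathbb{F}_q$ (with $\chi(0)=0$). In particular $|S_\lambda|=\frac14(3q+1)$ if $-1$ is a square in $\mathbb{F}_q$, and otherwise $|S_\lambda|=\frac14(3q-1)$ or $\frac14(3q+3)$.
   Context: For a polynomial $f\in\mathbb{F}_q[X]$ and a non-square $\lambda\in\mathbb{F}_q$, $\mathcal{G}(\lambda,f)$ is the directed graph with vertex set $\mathbb{F}_q$ and an edge from $x$ to $y$ iff $(y^2-f(x))(\lambda y^2-f(x))=0$ (loops allowed). A fixed vertex is a vertex with an edge (loop) from it to itself. -}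

module Defs where

open import Level using (0ℓ)
open import Data.Nat using (ℕ)
open import Data.Integer using (ℤ; +_; -[1+_])
open import Data.Fin using (Fin)
open import Data.Fin.Properties using (any?)
open import Data.List using (List; length; filter; map; allFin)
open import Data.Product using (Σ; ∃; _,_; proj₁; proj₂)
open import Relation.Nullary using (¬_; Dec; yes; no)
open import Relation.Unary using (Pred; Decidable)
open import Relation.Binary.PropositionalEquality using (_≡_; _≢_; refl; sym; subst)
open import Algebra.Structures using (IsCommutativeRing)
open import Function.Bundles using (_⤖_; Bijection)

record FiniteField : Set₁ where
  infixl 7 _*_
  infixl 6 _+_ _-_
  infix  8 -_
  field
    Carrier : Set
    _+_ _*_ : Carrier → Carrier → Carrier
    -_      : Carrier → Carrier
    0# 1#   : Carrier
    isCommutativeRing : IsCommutativeRing _≡_ _+_ _*_ -_ 0# 1#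
    _≟_     : (x y : Carrier) → Dec (x ≡ y)
    0≢1     : 0# ≢ 1#
    inverse : ∀ x → x ≢ 0# → ∃ λ y → x * y ≡ 1#
    q       : ℕ
    enum    : Fin q ⤖ Carrier

  _-_ : Carrier → Carrier → Carrier
  x - y = x + (- y)

  elements : List Carrier
  elements = map (Bijection.to enum) (allFin q)

  ∃? : {P : Pred Carrier 0ℓ} → Decidable P → Dec (∃ P)
  ∃? {P} P? with any? (λ i → P? (Bijection.to enum i))
  ... | yes (i , p) = yes (Bijection.to enum i , p)
  ... | no ¬p = no λ { (y , py) → ¬p (helper y py) }
    where
    helper : ∀ y → P y → ∃ λ i → P (Bijection.to enum i)
    helper y py with Bijection.strictlySurjective enum y
    ... | i , eq = i , subst P (sym eq) py

  card : {P : Pred Carrier 0ℓ} → Decidable P → ℕ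
  card P? = length (filter P? elements)

  IsSquare : Carrier → Set
  IsSquare x = ∃ λ y → y * y ≡ x

  isSquare? : Decidable IsSquare
  isSquare? x = ∃? (λ y → (y * y) ≟ x)

  χ : Carrier → ℤ
  χ x with x ≟ 0#
  ... | yes _ = + 0
  ... | no _ with isSquare? x
  ...   | yes _ = + 1
  ...   | no _  = -[1+ 0 ]

module _ (F : FiniteField) where
  open FiniteField F

  -- Edge relation of the graph G(μ, f): x → y iff (y² - f(x))(μ y² - f(x)) = 0.
  -- A polynomial f is represented by its polynomial function Carrier → Carrier.
  Edge : (μ : Carrier) (f : Carrier → Carrier) → Carrier → Carrier → Set
  Edge μ f x y = (y * y - f x) * (μ * (y * y) - f x) ≡ 0#

  HasFixedVertex : (μ : Carrier) (f : Carrier → Carrier) → Set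
  HasFixedVertex μ f = ∃ λ x → Edge μ f x x

  hasFixedVertex? : (μ : Carrier) (f : Carrier → Carrier) → Dec (HasFixedVertex μ f)
  hasFixedVertex? μ f = ∃? (λ x → ((x * x - f x) * (μ * (x * x) - f x)) ≟ 0#)

  S? : (μ : Carrier) → Decidable (λ a → HasFixedVertex μ (λ x → x + a))
  S? μ a = hasFixedVertex? μ (λ x → x + a)

  cardS : Carrier → ℕ
  cardS μ = card (S? μ)

-- For odd q, x² = x + a (resp. μx² = x + a) is solvable iff the discriminant 1 + 4a
-- (resp. 1 + 4μa) is a square, 0 included. Since multiplication by the nonsquare μ swaps
-- nonzero squares and nonsquares, a ↦ μ(1 + 4a) maps the complement of S_μ onto the nonzero
-- squares x with x + (1 - μ) a nonsquare. Counting these with indicator sums reduces |S_μ| to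
-- two classical counts: there are (q + 1)/2 squares, and v² - u² = c has q - 1 solutions for
-- c ≠ 0. Off zero χ = 2·[square] - 1, and χ(μ - 1) = χ(-1) χ(1 - μ) gives the special cases.

module Submission where

open import Defs
open import Level using (Level; 0ℓ)
open import Algebra.Bundles using (CommutativeRing)
open import Data.Fin as Fin using (Fin)
open import Data.Fin.Base using (punchIn)
import Data.Fin.Properties as Finₚ
open import Data.Fin.Permutation as Perm using (Permutation′)
open import Data.Integer as ℤ using (ℤ; +_; -[1+_]; _⊖_)
import Data.Integer.Properties as ℤₚ
import Data.Integer.Tactic.RingSolver as ℤ-Solver
open import Data.List using (length; filter; tabulate; map; allFin)
open import Data.List.Properties using (map-tabulate)
open import Data.Maybe using (Maybe; just; nothing)
open import Data.Nat as ℕ using (ℕ; zero; suc)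
open import Data.Nat.Divisibility using (_∣_; divides; ∣1⇒≡1)
open import Data.Nat.Primality using (Prime; euclidsLemma; prime?; prime⇒irreducible)
import Data.Nat.Properties as ℕₚ
import Data.Nat.Tactic.RingSolver as ℕ-Solver
open import Data.Product as Product using (∃; _,_; proj₁; proj₂)
open import Data.Sum as Sum using (_⊎_; inj₁; inj₂; [_,_])
open import Data.Vec.Functional using (Vector; removeAt)
open import Function using (_∘_; id)
open import Function.Bundles using (_⤖_; Inverse)
open import Function.Properties.Bijection using (⤖⇒↔)
open import Relation.Binary.Definitions using (DecidableEquality; tri<; tri≈; tri>)
open import Relation.Binary.PropositionalEquality as ≡ using (_≡_; _≢_; module ≡-Reasoning)
open import Relation.Nullary using (Dec; yes; no; ¬_; contradiction)
open import Relation.Nullary.Decidable using (from-yes)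
open import Relation.Unary using (Pred; Decidable)

import Algebra.Properties.Semiring.Sum ℕₚ.+-*-semiring as VectorSum
open VectorSum using (sum; sum-remove; sum-cong-≗; sum-replicate-zero)

module IntegerCoefficients {r₁ r₂ : Level} (R : CommutativeRing r₁ r₂) where
  open CommutativeRing R
  open import Algebra.Solver.Ring.AlmostCommutativeRing
    using (fromCommutativeRing; _-Raw-AlmostCommutative⟶_)
  open import Algebra.Properties.Ring ring using ([y-z]x≈yx-zx; x[y-z]≈xy-xz)
  open import Algebra.Properties.AbelianGroup +-abelianGroup using (⁻¹-∙-comm; ⁻¹-anti-homo‿-)
  open import Algebra.Properties.Group +-group using (ε⁻¹≈ε)
  open import Algebra.Properties.CommutativeSemigroup +-commutativeSemigroup using (interchange)
  open import Algebra.Properties.Semiring.Mult.TCOptimised semiring using (_×_; ×-homo-+; ×1-homo-*; 1+×)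
  open import Relation.Binary.Reasoning.Setoid setoid

  -- With the optimised _×_, ⟦ + 1 ⟧ᶻ is definitionally 1#, so solver constants match 1#.
  ⟦_⟧ᶻ : ℤ → Carrier
  ⟦ + n ⟧ᶻ = n × 1#
  ⟦ -[1+ n ] ⟧ᶻ = - (suc n × 1#)

  [a-b]+[c-d]≈[a+c]-[b+d] : ∀ a b c d → (a - b) + (c - d) ≈ (a + c) - (b + d)
  [a-b]+[c-d]≈[a+c]-[b+d] a b c d = begin
    (a - b) + (c - d)   ≈⟨ interchange a (- b) c (- d) ⟩
    (a + c) + (- b - d) ≈⟨ +-congˡ (⁻¹-∙-comm b d) ⟩
    (a + c) - (b + d)   ∎

  [a-b]*[c-d]≈[ac+bd]-[ad+bc] : ∀ a b c d → (a - b) * (c - d) ≈ (a * c + b * d) - (a * d + b * c)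
  [a-b]*[c-d]≈[ac+bd]-[ad+bc] a b c d = begin
    (a - b) * (c - d)                   ≈⟨ x[y-z]≈xy-xz (a - b) c d ⟩
    (a - b) * c - (a - b) * d           ≈⟨ +-cong ([y-z]x≈yx-zx c a b) (-‿cong ([y-z]x≈yx-zx d a b)) ⟩
    (a * c - b * c) - (a * d - b * d)   ≈⟨ +-congˡ (⁻¹-anti-homo‿- (a * d) (b * d)) ⟩
    (a * c - b * c) + (b * d - a * d)   ≈⟨ [a-b]+[c-d]≈[a+c]-[b+d] (a * c) (b * c) (b * d) (a * d) ⟩
    (a * c + b * d) - (b * c + a * d)   ≈⟨ +-congˡ (-‿cong (+-comm (b * c) (a * d))) ⟩
    (a * c + b * d) - (a * d + b * c)   ∎

  ⟦⊖⟧ : ∀ m n → ⟦ m ⊖ n ⟧ᶻ ≈ m × 1# - n × 1#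
  ⟦⊖⟧ zero zero = sym (trans (+-congˡ ε⁻¹≈ε) (+-identityʳ 0#))
  ⟦⊖⟧ zero (suc n) = sym (+-identityˡ _)
  ⟦⊖⟧ (suc m) zero = sym (trans (+-congˡ ε⁻¹≈ε) (+-identityʳ _))
  ⟦⊖⟧ (suc m) (suc n) = begin
    ⟦ suc m ⊖ suc n ⟧ᶻ              ≡⟨ ≡.cong ⟦_⟧ᶻ (ℤₚ.[1+m]⊖[1+n]≡m⊖n m n) ⟩
    ⟦ m ⊖ n ⟧ᶻ                      ≈⟨ ⟦⊖⟧ m n ⟩
    m × 1# - n × 1#                 ≈⟨ +-identityˡ _ ⟨
    0# + (m × 1# - n × 1#)          ≈⟨ +-congʳ (-‿inverseʳ 1#) ⟨
    (1# - 1#) + (m × 1# - n × 1#)   ≈⟨ [a-b]+[c-d]≈[a+c]-[b+d] 1# 1# (m × 1#) (n × 1#) ⟩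
    (1# + m × 1#) - (1# + n × 1#)   ≈⟨ +-cong (1+× m 1#) (-‿cong (1+× n 1#)) ⟨
    suc m × 1# - suc n × 1#         ∎

  ⟦-⟧ : ∀ m n → ⟦ + m ℤ.- + n ⟧ᶻ ≈ m × 1# - n × 1#
  ⟦-⟧ m n = trans (reflexive (≡.cong ⟦_⟧ᶻ (ℤₚ.m-n≡m⊖n m n))) (⟦⊖⟧ m n)

  positivePart negativePart : ℤ → ℕ
  positivePart (+ n) = n
  positivePart -[1+ n ] = 0
  negativePart (+ n) = 0
  negativePart -[1+ n ] = suc n

  ≡positive-negative : ∀ i → i ≡ + positivePart i ℤ.- + negativePart i
  ≡positive-negative (+ n) = ≡.sym (ℤₚ.m-n≡m⊖n n 0)
  ≡positive-negative -[1+ n ] = ≡.refl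

  ⟦⟧ᶻ-positive-negative : ∀ i → ⟦ i ⟧ᶻ ≈ positivePart i × 1# - negativePart i × 1#
  ⟦⟧ᶻ-positive-negative i = trans (reflexive (≡.cong ⟦_⟧ᶻ (≡positive-negative i))) (⟦-⟧ (positivePart i) (negativePart i))

  +-homo : ∀ i j → ⟦ i ℤ.+ j ⟧ᶻ ≈ ⟦ i ⟧ᶻ + ⟦ j ⟧ᶻ
  +-homo i j = begin
    ⟦ i ℤ.+ j ⟧ᶻ                              ≡⟨ ≡.cong ⟦_⟧ᶻ (≡.trans (≡.cong₂ ℤ._+_ (≡positive-negative i) (≡positive-negative j)) sum-as-difference) ⟩
    ⟦ + (a ℕ.+ c) ℤ.- + (b ℕ.+ d) ⟧ᶻ          ≈⟨ ⟦-⟧ (a ℕ.+ c) (b ℕ.+ d) ⟩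
    (a ℕ.+ c) × 1# - (b ℕ.+ d) × 1#           ≈⟨ +-cong (×-homo-+ 1# a c) (-‿cong (×-homo-+ 1# b d)) ⟩
    (a × 1# + c × 1#) - (b × 1# + d × 1#)     ≈⟨ [a-b]+[c-d]≈[a+c]-[b+d] (a × 1#) (b × 1#) (c × 1#) (d × 1#) ⟨
    (a × 1# - b × 1#) + (c × 1# - d × 1#)     ≈⟨ +-cong (⟦⟧ᶻ-positive-negative i) (⟦⟧ᶻ-positive-negative j) ⟨
    ⟦ i ⟧ᶻ + ⟦ j ⟧ᶻ                           ∎
    where
    a = positivePart i ; b = negativePart i ; c = positivePart j ; d = negativePart j
    sum-as-difference : (+ a ℤ.- + b) ℤ.+ (+ c ℤ.- + d) ≡ + (a ℕ.+ c) ℤ.- + (b ℕ.+ d)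
    sum-as-difference = ≡.trans (ℤ-identity (+ a) (+ b) (+ c) (+ d))
                        (≡.cong₂ ℤ._-_ (≡.sym (ℤₚ.pos-+ a c)) (≡.sym (ℤₚ.pos-+ b d)))
      where
      ℤ-identity : ∀ a b c d → (a ℤ.- b) ℤ.+ (c ℤ.- d) ≡ (a ℤ.+ c) ℤ.- (b ℤ.+ d)
      ℤ-identity = ℤ-Solver.solve-∀

  *-homo : ∀ i j → ⟦ i ℤ.* j ⟧ᶻ ≈ ⟦ i ⟧ᶻ * ⟦ j ⟧ᶻ
  *-homo i j = begin
    ⟦ i ℤ.* j ⟧ᶻ                                        ≡⟨ ≡.cong ⟦_⟧ᶻ (≡.trans (≡.cong₂ ℤ._*_ (≡positive-negative i) (≡positive-negative j)) product-as-difference) ⟩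
    ⟦ + (a ℕ.* c ℕ.+ b ℕ.* d) ℤ.- + (a ℕ.* d ℕ.+ b ℕ.* c) ⟧ᶻ ≈⟨ ⟦-⟧ (a ℕ.* c ℕ.+ b ℕ.* d) (a ℕ.* d ℕ.+ b ℕ.* c) ⟩
    (a ℕ.* c ℕ.+ b ℕ.* d) × 1# - (a ℕ.* d ℕ.+ b ℕ.* c) × 1#  ≈⟨ +-cong (×-homo-* a c b d) (-‿cong (×-homo-* a d b c)) ⟩
    (A * C + B * D) - (A * D + B * C)                   ≈⟨ [a-b]*[c-d]≈[ac+bd]-[ad+bc] A B C D ⟨
    (A - B) * (C - D)                                   ≈⟨ *-cong (⟦⟧ᶻ-positive-negative i) (⟦⟧ᶻ-positive-negative j) ⟨
    ⟦ i ⟧ᶻ * ⟦ j ⟧ᶻ                                     ∎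
    where
    a = positivePart i ; b = negativePart i ; c = positivePart j ; d = negativePart j
    A = a × 1# ; B = b × 1# ; C = c × 1# ; D = d × 1#
    ×-homo-* : ∀ a c b d → (a ℕ.* c ℕ.+ b ℕ.* d) × 1# ≈ (a × 1#) * (c × 1#) + (b × 1#) * (d × 1#)
    ×-homo-* a c b d = trans (×-homo-+ 1# (a ℕ.* c) (b ℕ.* d)) (+-cong (×1-homo-* a c) (×1-homo-* b d))
    product-as-difference : (+ a ℤ.- + b) ℤ.* (+ c ℤ.- + d) ≡ + (a ℕ.* c ℕ.+ b ℕ.* d) ℤ.- + (a ℕ.* d ℕ.+ b ℕ.* c)
    product-as-difference = ≡.trans (ℤ-identity (+ a) (+ b) (+ c) (+ d))
      (≡.cong₂ ℤ._-_ (≡.sym (≡.trans (ℤₚ.pos-+ (a ℕ.* c) (b ℕ.* d)) (≡.cong₂ ℤ._+_ (ℤₚ.pos-* a c) (ℤₚ.pos-* b d))))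
                     (≡.sym (≡.trans (ℤₚ.pos-+ (a ℕ.* d) (b ℕ.* c)) (≡.cong₂ ℤ._+_ (ℤₚ.pos-* a d) (ℤₚ.pos-* b c)))))
      where
      ℤ-identity : ∀ a b c d → (a ℤ.- b) ℤ.* (c ℤ.- d) ≡ (a ℤ.* c ℤ.+ b ℤ.* d) ℤ.- (a ℤ.* d ℤ.+ b ℤ.* c)
      ℤ-identity = ℤ-Solver.solve-∀

  -‿homo : ∀ i → ⟦ ℤ.- i ⟧ᶻ ≈ - ⟦ i ⟧ᶻ
  -‿homo i = begin
    ⟦ ℤ.- i ⟧ᶻ                      ≡⟨ ≡.cong ⟦_⟧ᶻ (≡.trans (≡.cong ℤ.-_ (≡positive-negative i)) (ℤ-identity (+ a) (+ b))) ⟩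
    ⟦ + b ℤ.- + a ⟧ᶻ                ≈⟨ ⟦-⟧ b a ⟩
    b × 1# - a × 1#                 ≈⟨ ⁻¹-anti-homo‿- (a × 1#) (b × 1#) ⟨
    - (a × 1# - b × 1#)             ≈⟨ -‿cong (⟦⟧ᶻ-positive-negative i) ⟨
    - ⟦ i ⟧ᶻ                        ∎
    where
    a = positivePart i ; b = negativePart i
    ℤ-identity : ∀ a b → ℤ.- (a ℤ.- b) ≡ b ℤ.- a
    ℤ-identity = ℤ-Solver.solve-∀

  homomorphism : ℤ.+-*-rawRing -Raw-AlmostCommutative⟶ fromCommutativeRing R
  homomorphism = record
    { ⟦_⟧ = ⟦_⟧ᶻ ; +-homo = +-homo ; *-homo = *-homo ; -‿homo = -‿homo ; 0-homo = refl ; 1-homo = refl }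

  ≟-coefficients : ∀ i j → Maybe (⟦ i ⟧ᶻ ≈ ⟦ j ⟧ᶻ)
  ≟-coefficients i j with i ℤₚ.≟ j
  ... | yes ≡.refl = just refl
  ... | no _ = nothing

  open import Algebra.Solver.Ring ℤ.+-*-rawRing (fromCommutativeRing R) homomorphism ≟-coefficients public
    using (solve; _:=_; _:+_; _:*_; :-_; _:-_; con)

indicator : ∀ {a} {A : Set a} → Dec A → ℕ
indicator (yes _) = 1
indicator (no _) = 0

indicator-yes : ∀ {a} {A : Set a} (d : Dec A) → A → indicator d ≡ 1
indicator-yes (yes _) _ = ≡.refl
indicator-yes (no ¬a) a = contradiction a ¬a

indicator-no : ∀ {a} {A : Set a} (d : Dec A) → ¬ A → indicator d ≡ 0
indicator-no (yes a) ¬a = contradiction a ¬a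
indicator-no (no _) _ = ≡.refl

indicator≡1⇒ : ∀ {a} {A : Set a} (d : Dec A) → indicator d ≡ 1 → A
indicator≡1⇒ (yes a) _ = a

indicator≤1 : ∀ {a} {A : Set a} (d : Dec A) → indicator d ℕ.≤ 1
indicator≤1 (yes _) = ℕ.s≤s ℕ.z≤n
indicator≤1 (no _) = ℕ.z≤n

indicator-cong : ∀ {a b} {A : Set a} {B : Set b} (d : Dec A) (e : Dec B) → (A → B) → (B → A) → indicator d ≡ indicator e
indicator-cong (yes _) (yes _) _ _ = ≡.refl
indicator-cong (yes a) (no ¬b) f _ = contradiction (f a) ¬b
indicator-cong (no ¬a) (yes b) _ g = contradiction (g b) ¬a
indicator-cong (no _) (no _) _ _ = ≡.refl

length-filter-tabulate : ∀ {a} {A : Set a} {P : Pred A 0ℓ} (P? : Decidable P) {n} (f : Fin n → A) →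
                         length (filter P? (tabulate f)) ≡ sum (λ i → indicator (P? (f i)))
length-filter-tabulate P? {zero} f = ≡.refl
length-filter-tabulate P? {suc n} f with P? (f Fin.zero)
... | yes _ = ≡.cong suc (length-filter-tabulate P? (f ∘ Fin.suc))
... | no _ = length-filter-tabulate P? (f ∘ Fin.suc)

sum-single : ∀ {n} (t : Vector ℕ n) (i : Fin n) → (∀ j → j ≢ i → t j ≡ 0) → sum t ≡ t i
sum-single {suc n} t i vanish = begin
  sum t                        ≡⟨ sum-remove {i = i} t ⟩
  t i ℕ.+ sum (removeAt t i)   ≡⟨ ≡.cong (t i ℕ.+_) (≡.trans (sum-cong-≗ (λ j → vanish (punchIn i j) (Finₚ.punchInᵢ≢i i j))) (sum-replicate-zero n)) ⟩
  t i ℕ.+ 0                    ≡⟨ ℕₚ.+-identityʳ (t i) ⟩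
  t i                          ∎
  where open ≡-Reasoning

sum≡0⇒≡0 : ∀ {n} (t : Vector ℕ n) → sum t ≡ 0 → ∀ i → t i ≡ 0
sum≡0⇒≡0 {suc n} t eq i = ℕₚ.m+n≡0⇒m≡0 (t i) (≡.trans (≡.sym (sum-remove {i = i} t)) eq)

sum-replicate-1 : ∀ n → sum {n} (λ _ → 1) ≡ n
sum-replicate-1 zero = ≡.refl
sum-replicate-1 (suc n) = ≡.cong suc (sum-replicate-1 n)

module FiniteSums {a} {A : Set a} {n : ℕ} (enum : Fin n ⤖ A) where
  open Inverse (⤖⇒↔ enum) using (to; from; strictlyInverseˡ; strictlyInverseʳ)
  open import Data.Nat using (_+_; _*_; _∸_; _≤_)
  open ≡-Reasoning

  ∑ : (A → ℕ) → ℕ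
  ∑ g = sum (g ∘ to)

  ∑-cong : ∀ {g h : A → ℕ} → (∀ x → g x ≡ h x) → ∑ g ≡ ∑ h
  ∑-cong g≗h = sum-cong-≗ (g≗h ∘ to)

  ∑-+ : ∀ (g h : A → ℕ) → ∑ (λ x → g x + h x) ≡ ∑ g + ∑ h
  ∑-+ g h = VectorSum.∑-distrib-+ (g ∘ to) (h ∘ to)

  ∑-*ˡ : ∀ k (g : A → ℕ) → ∑ (λ x → k * g x) ≡ k * ∑ g
  ∑-*ˡ k g = ≡.sym (VectorSum.*-distribˡ-sum k (g ∘ to))

  ∑-*ʳ : ∀ (g : A → ℕ) k → ∑ g * k ≡ ∑ (λ x → g x * k)
  ∑-*ʳ g k = ≡.trans (ℕₚ.*-comm (∑ g) k) (≡.trans (≡.sym (∑-*ˡ k g)) (∑-cong (λ x → ℕₚ.*-comm k (g x))))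

  ∑-comm : ∀ (g : A → A → ℕ) → ∑ (λ x → ∑ (g x)) ≡ ∑ (λ y → ∑ (λ x → g x y))
  ∑-comm g = VectorSum.∑-comm (λ i j → g (to i) (to j))

  ∑-0 : ∑ (λ _ → 0) ≡ 0
  ∑-0 = sum-replicate-zero n

  ∑-1 : ∑ (λ _ → 1) ≡ n
  ∑-1 = sum-replicate-1 n

  ∑-reindex : ∀ (π π⁻¹ : A → A) → (∀ x → π⁻¹ (π x) ≡ x) → (∀ y → π (π⁻¹ y) ≡ y) →
              ∀ (g : A → ℕ) → ∑ (g ∘ π) ≡ ∑ g
  ∑-reindex π π⁻¹ π⁻¹∘π π∘π⁻¹ g = ≡.sym (begin
    ∑ g                                ≡⟨ VectorSum.∑-permute (g ∘ to) permutation ⟩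
    sum (λ i → g (to (from (π (to i))))) ≡⟨ sum-cong-≗ (λ i → ≡.cong g (strictlyInverseˡ (π (to i)))) ⟩
    ∑ (g ∘ π)                          ∎)
    where
    permutation : Permutation′ n
    permutation = Perm.permutation (from ∘ π ∘ to) (from ∘ π⁻¹ ∘ to)
      (λ i → ≡.trans (≡.cong (from ∘ π) (strictlyInverseˡ (π⁻¹ (to i)))) (≡.trans (≡.cong from (π∘π⁻¹ (to i))) (strictlyInverseʳ i)))
      (λ i → ≡.trans (≡.cong (from ∘ π⁻¹) (strictlyInverseˡ (π (to i)))) (≡.trans (≡.cong from (π⁻¹∘π (to i))) (strictlyInverseʳ i)))

  ∑-single : ∀ (g : A → ℕ) z → (∀ x → x ≢ z → g x ≡ 0) → ∑ g ≡ g z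
  ∑-single g z vanish = begin
    ∑ g             ≡⟨ sum-single (g ∘ to) (from z) (λ i i≢ → vanish (to i) (λ to-i≡z → i≢ (≡.trans (≡.sym (strictlyInverseʳ i)) (≡.cong from to-i≡z)))) ⟩
    g (to (from z)) ≡⟨ ≡.cong g (strictlyInverseˡ z) ⟩
    g z             ∎

  ∑≡0⇒≡0 : ∀ (g : A → ℕ) → ∑ g ≡ 0 → ∀ x → g x ≡ 0
  ∑≡0⇒≡0 g ∑g≡0 x = ≡.trans (≡.cong g (≡.sym (strictlyInverseˡ x))) (sum≡0⇒≡0 (g ∘ to) ∑g≡0 (from x))

  ∑-mono-≡⇒≗ : ∀ (g h : A → ℕ) → (∀ x → g x ≤ h x) → ∑ g ≡ ∑ h → ∀ x → g x ≡ h x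
  ∑-mono-≡⇒≗ g h g≤h ∑g≡∑h x = ℕₚ.≤-antisym (g≤h x) (ℕₚ.m∸n≡0⇒m≤n (∑≡0⇒≡0 d ∑d≡0 x))
    where
    d : A → ℕ
    d x = h x ∸ g x
    ∑d≡0 : ∑ d ≡ 0
    ∑d≡0 = ℕₚ.+-cancelʳ-≡ (∑ g) (∑ d) 0 (begin
      ∑ d + ∑ g              ≡⟨ ∑-+ d g ⟨
      ∑ (λ x → d x + g x)    ≡⟨ ∑-cong (λ x → ℕₚ.m∸n+n≡m (g≤h x)) ⟩
      ∑ h                    ≡⟨ ∑g≡∑h ⟨
      ∑ g                    ∎)

  ∑-indicator-≡ : ∀ (_≟_ : DecidableEquality A) y → ∑ (λ x → indicator (x ≟ y)) ≡ 1
  ∑-indicator-≡ _≟_ y = ≡.trans (∑-single _ y (λ x x≢y → indicator-no (x ≟ y) x≢y)) (indicator-yes (y ≟ y) ≡.refl)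

  ∑-indicator-≡′ : ∀ (_≟_ : DecidableEquality A) y → ∑ (λ x → indicator (y ≟ x)) ≡ 1
  ∑-indicator-≡′ _≟_ y = ≡.trans (∑-cong (λ x → indicator-cong (y ≟ x) (x ≟ y) ≡.sym ≡.sym)) (∑-indicator-≡ _≟_ y)

  ∑-indicator-* : ∀ (_≟_ : DecidableEquality A) y (h : A → ℕ) → ∑ (λ x → indicator (y ≟ x) * h x) ≡ h y
  ∑-indicator-* _≟_ y h = begin
    ∑ (λ x → indicator (y ≟ x) * h x)   ≡⟨ ∑-single _ y (λ x x≢y → ≡.cong (_* h x) (indicator-no (y ≟ x) (x≢y ∘ ≡.sym))) ⟩
    indicator (y ≟ y) * h y             ≡⟨ ≡.cong (_* h y) (indicator-yes (y ≟ y) ≡.refl) ⟩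
    1 * h y                             ≡⟨ ℕₚ.*-identityˡ (h y) ⟩
    h y                                 ∎

  ∑-indicator-*′ : ∀ (_≟_ : DecidableEquality A) y (h : A → ℕ) → ∑ (λ x → indicator (x ≟ y) * h x) ≡ h y
  ∑-indicator-*′ _≟_ y h = ≡.trans (∑-cong (λ x → ≡.cong (_* h x) (indicator-cong (x ≟ y) (y ≟ x) ≡.sym ≡.sym)))
                                   (∑-indicator-* _≟_ y h)

  length-filter : ∀ {P : Pred A 0ℓ} (P? : Decidable P) →
                  length (filter P? (map to (allFin n))) ≡ ∑ (λ x → indicator (P? x))
  length-filter P? = ≡.trans (≡.cong (length ∘ filter P?) (map-tabulate id to)) (length-filter-tabulate P? to)

module FieldArithmetic (F : FiniteField) where
  open FiniteField F
  open ≡-Reasoning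

  commutativeRing : CommutativeRing 0ℓ 0ℓ
  commutativeRing = record { isCommutativeRing = isCommutativeRing }

  open CommutativeRing commutativeRing public
    using (+-comm; +-identityˡ; +-identityʳ; -‿inverseˡ; -‿inverseʳ; *-comm; *-assoc; *-identityˡ; zeroˡ; zeroʳ)
  open IntegerCoefficients commutativeRing public
    using (⟦_⟧ᶻ; solve; _:=_; _:+_; _:*_; :-_; _:-_; con)

  two four : Carrier
  two = ⟦ + 2 ⟧ᶻ
  four = ⟦ + 4 ⟧ᶻ

  _⁻¹⟨_⟩ : ∀ x → x ≢ 0# → Carrier
  x ⁻¹⟨ x≢0 ⟩ = proj₁ (inverse x x≢0)

  *-inverseʳ : ∀ x (x≢0 : x ≢ 0#) → x * x ⁻¹⟨ x≢0 ⟩ ≡ 1#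
  *-inverseʳ x x≢0 = proj₂ (inverse x x≢0)

  *-cancelˡ : ∀ {k a b} → k ≢ 0# → k * a ≡ k * b → a ≡ b
  *-cancelˡ {k} {a} {b} k≢0 ka≡kb = begin
    a                   ≡⟨ *-identityˡ a ⟨
    1# * a              ≡⟨ ≡.cong (_* a) k⁻¹k≡1 ⟨
    (k⁻¹ * k) * a       ≡⟨ *-assoc k⁻¹ k a ⟩
    k⁻¹ * (k * a)       ≡⟨ ≡.cong (k⁻¹ *_) ka≡kb ⟩
    k⁻¹ * (k * b)       ≡⟨ *-assoc k⁻¹ k b ⟨
    (k⁻¹ * k) * b       ≡⟨ ≡.cong (_* b) k⁻¹k≡1 ⟩
    1# * b              ≡⟨ *-identityˡ b ⟩
    b                   ∎
    where
    k⁻¹ = k ⁻¹⟨ k≢0 ⟩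
    k⁻¹k≡1 : k⁻¹ * k ≡ 1#
    k⁻¹k≡1 = ≡.trans (*-comm k⁻¹ k) (*-inverseʳ k k≢0)

  open import Algebra.Properties.Group (CommutativeRing.+-group commutativeRing) public
    using (∙-cancelʳ; inverseˡ-unique; inverseʳ-unique; x∙y⁻¹≈ε⇒x≈y)

  1≢0 : 1# ≢ 0#
  1≢0 = 0≢1 ∘ ≡.sym

  *-≡0 : ∀ {x y} → x * y ≡ 0# → x ≡ 0# ⊎ y ≡ 0#
  *-≡0 {x} {y} xy≡0 with x ≟ 0#
  ... | yes x≡0 = inj₁ x≡0
  ... | no x≢0 = inj₂ (*-cancelˡ x≢0 (≡.trans xy≡0 (≡.sym (zeroʳ x))))

  *-≢0 : ∀ {x y} → x ≢ 0# → y ≢ 0# → x * y ≢ 0#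
  *-≢0 x≢0 y≢0 xy≡0 = [ x≢0 , y≢0 ] (*-≡0 xy≡0)

  *-≡0-cancelˡ : ∀ {k x} → k ≢ 0# → k * x ≡ 0# → x ≡ 0#
  *-≡0-cancelˡ {k} k≢0 kx≡0 = [ (λ k≡0 → contradiction k≡0 k≢0) , id ] (*-≡0 kx≡0)

  -‿≢0 : ∀ {x} → x ≢ 0# → - x ≢ 0#
  -‿≢0 {x} x≢0 -x≡0 = x≢0 (begin
    x            ≡⟨ +-identityʳ x ⟨
    x + 0#       ≡⟨ ≡.cong (_+_ x) -x≡0 ⟨
    x + - x      ≡⟨ -‿inverseʳ x ⟩
    0#           ∎)

  square≡0⇒≡0 : ∀ {u} → u * u ≡ 0# → u ≡ 0#
  square≡0⇒≡0 uu≡0 = [ id , id ] (*-≡0 uu≡0)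

  square-injective : ∀ {u w} → u * u ≡ w * w → u ≡ w ⊎ u ≡ - w
  square-injective {u} {w} uu≡ww = Sum.map (x∙y⁻¹≈ε⇒x≈y u w) (λ u+w≡0 → inverseʳ-unique w u (≡.trans (+-comm w u) u+w≡0))
    (*-≡0 (begin
      (u - w) * (u + w)   ≡⟨ solve 2 (λ u w → (u :- w) :* (u :+ w) := u :* u :- w :* w) ≡.refl u w ⟩
      u * u - w * w       ≡⟨ ≡.cong (_- w * w) uu≡ww ⟩
      w * w - w * w       ≡⟨ -‿inverseʳ (w * w) ⟩
      0#                  ∎))

  IsSquare-0 : IsSquare 0#
  IsSquare-0 = 0# , zeroˡ 0#

  IsSquare-* : ∀ {x y} → IsSquare x → IsSquare y → IsSquare (x * y)
  IsSquare-* {x} {y} (u , uu≡x) (v , vv≡y) = u * v , (begin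
    (u * v) * (u * v)   ≡⟨ solve 2 (λ u v → (u :* v) :* (u :* v) := (u :* u) :* (v :* v)) ≡.refl u v ⟩
    (u * u) * (v * v)   ≡⟨ ≡.cong₂ _*_ uu≡x vv≡y ⟩
    x * y               ∎)

¬2∣odd-prime^n : ∀ {p} n → Prime p → p ≢ 2 → ¬ 2 ∣ p ℕ.^ n
¬2∣odd-prime^n zero _ _ 2∣1 = contradiction (∣1⇒≡1 2∣1) (λ ())
¬2∣odd-prime^n {p} (suc n) p-prime p≢2 2∣p^[1+n] with euclidsLemma p (p ℕ.^ n) (from-yes (prime? 2)) 2∣p^[1+n]
... | inj₂ 2∣p^n = ¬2∣odd-prime^n n p-prime p≢2 2∣p^n
... | inj₁ 2∣p with prime⇒irreducible p-prime 2∣p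
...   | inj₂ 2≡p = p≢2 (≡.sym 2≡p)

indicator-<-swap : ∀ {i j} → i ≢ j → indicator (i ℕₚ.<? j) ℕ.+ indicator (j ℕₚ.<? i) ≡ 1
indicator-<-swap {i} {j} i≢j with ℕₚ.<-cmp i j
... | tri< i<j _ j≮i = ≡.cong₂ ℕ._+_ (indicator-yes (i ℕₚ.<? j) i<j) (indicator-no (j ℕₚ.<? i) j≮i)
... | tri≈ _ i≡j _ = contradiction i≡j i≢j
... | tri> i≮j _ j<i = ≡.cong₂ ℕ._+_ (indicator-no (i ℕₚ.<? j) i≮j) (indicator-yes (j ℕₚ.<? i) j<i)

module _ where
  open import Data.Nat using (_+_; _*_)
  open ≡-Reasoning

  -- The weighted sum 4 h₁ - 4 h₂ - 2 h₃ + h₄ of the hypotheses, with negative terms moved across.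
  eliminate-N-M-E : ∀ {S N M E e₊ e₋ q} → S + N ≡ q → N + M + 1 ≡ E + e₊ → 2 * E ≡ q + 1 →
              4 * M + 1 ≡ q + 2 * e₋ + 2 * e₊ → 4 * S + 2 * e₊ ≡ 3 * q + 1 + 2 * e₋
  eliminate-N-M-E {S} {N} {M} {E} {e₊} {e₋} {q} h₁ h₂ h₃ h₄ = ℕₚ.+-cancelʳ-≡ K _ _ (begin
    (4 * S + 2 * e₊) + K                                                               ≡⟨ identity S N M E e₊ e₋ q ⟩
    (3 * q + 1 + 2 * e₋) + (4 * (S + N) + 4 * (E + e₊) + 2 * (q + 1) + (4 * M + 1))   ≡⟨ ≡.cong (_+_ (3 * q + 1 + 2 * e₋)) substitute ⟩
    (3 * q + 1 + 2 * e₋) + K                                                           ∎)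
    where
    K = 4 * q + 4 * (N + M + 1) + 2 * (2 * E) + (q + 2 * e₋ + 2 * e₊)
    substitute : 4 * (S + N) + 4 * (E + e₊) + 2 * (q + 1) + (4 * M + 1) ≡ K
    substitute = ≡.cong₂ _+_ (≡.cong₂ _+_ (≡.cong₂ _+_ (≡.cong (4 *_) h₁) (≡.cong (4 *_) (≡.sym h₂))) (≡.cong (2 *_) (≡.sym h₃))) h₄
    identity : ∀ S N M E e₊ e₋ q →
      (4 * S + 2 * e₊) + (4 * q + 4 * (N + M + 1) + 2 * (2 * E) + (q + 2 * e₋ + 2 * e₊))
      ≡ (3 * q + 1 + 2 * e₋) + (4 * (S + N) + 4 * (E + e₊) + 2 * (q + 1) + (4 * M + 1))
    identity = ℕ-Solver.solve-∀

  cases-e₊+e₋≡1 : ∀ {a b} e₊ e₋ → e₊ + e₋ ≡ 1 → a + 2 * e₊ ≡ b + 1 + 2 * e₋ → (a + 1 ≡ b) ⊎ (a ≡ b + 3)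
  cases-e₊+e₋≡1 {a} {b} 0 1 _ eq = inj₂ (≡.trans (≡.sym (ℕₚ.+-identityʳ a)) (≡.trans eq (ℕₚ.+-assoc b 1 2)))
  cases-e₊+e₋≡1 {a} {b} 1 0 _ eq = inj₁ (ℕₚ.+-cancelʳ-≡ 1 (a + 1) b
    (≡.trans (ℕₚ.+-assoc a 1 1) (≡.trans eq (ℕₚ.+-identityʳ (b + 1)))))

module Characteristic (F : FiniteField) where
  open FiniteField F
  open FieldArithmetic F
  open FiniteSums enum
  open Inverse (⤖⇒↔ enum) using (to; from; strictlyInverseˡ)
  open ≡-Reasoning

  -- If 1 + 1 = 0 then x ↦ x + 1 is a fixed-point-free involution, and exactly one element of
  -- each pair {x, x + 1} has the smaller index.
  two≡0⇒2∣q : two ≡ 0# → 2 ∣ q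
  two≡0⇒2∣q two≡0 = divides (∑ first) (begin
    q                                       ≡⟨ ∑-1 ⟨
    ∑ (λ _ → 1)                             ≡⟨ ∑-cong first-of-pair ⟨
    ∑ (λ x → first x ℕ.+ first (x + 1#))   ≡⟨ ∑-+ first (first ∘ (_+ 1#)) ⟩
    ∑ first ℕ.+ ∑ (first ∘ (_+ 1#))        ≡⟨ ≡.cong (∑ first ℕ.+_) (∑-reindex (_+ 1#) (_+ 1#) involutive involutive first) ⟩
    ∑ first ℕ.+ ∑ first                     ≡⟨ solve-ℕ (∑ first) ⟩
    ∑ first ℕ.* 2                           ∎)
    where
    index : Carrier → ℕ
    index = Fin.toℕ ∘ from
    first : Carrier → ℕ
    first x = indicator (index x ℕₚ.<? index (x + 1#))
    involutive : ∀ x → x + 1# + 1# ≡ x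
    involutive x = ≡.trans (solve 1 (λ x → x :+ con (+ 1) :+ con (+ 1) := x :+ con (+ 2)) ≡.refl x)
                           (≡.trans (≡.cong (_+_ x) two≡0) (+-identityʳ x))
    x≢x+1 : ∀ x → x ≢ x + 1#
    x≢x+1 x x≡x+1 = 0≢1 (∙-cancelʳ x 0# 1# (≡.trans (+-identityˡ x) (≡.trans x≡x+1 (+-comm x 1#))))
    first-of-pair : ∀ x → first x ℕ.+ first (x + 1#) ≡ 1
    first-of-pair x = ≡.trans (≡.cong (λ y → first x ℕ.+ indicator (index (x + 1#) ℕₚ.<? index y)) (involutive x))
      (indicator-<-swap (λ eq → x≢x+1 x (≡.trans (≡.sym (strictlyInverseˡ x)) (≡.trans (≡.cong to (Finₚ.toℕ-injective eq)) (strictlyInverseˡ (x + 1#))))))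
    solve-ℕ : ∀ n → n ℕ.+ n ≡ n ℕ.* 2
    solve-ℕ = ℕ-Solver.solve-∀

module FieldSums (F : FiniteField) where
  open FiniteField F
  open FieldArithmetic F
  open FiniteSums enum public
  open ≡-Reasoning

  ∑-affine : ∀ {a} b → a ≢ 0# → (g : Carrier → ℕ) → ∑ (λ u → g (a * u + b)) ≡ ∑ g
  ∑-affine {a} b a≢0 = ∑-reindex (λ u → a * u + b) (λ y → a⁻¹ * (y - b)) left right
    where
    a⁻¹ = a ⁻¹⟨ a≢0 ⟩
    left : ∀ u → a⁻¹ * ((a * u + b) - b) ≡ u
    left u = begin
      a⁻¹ * ((a * u + b) - b)   ≡⟨ solve 4 (λ a a⁻¹ u b → a⁻¹ :* ((a :* u :+ b) :- b) := (a :* a⁻¹) :* u) ≡.refl a a⁻¹ u b ⟩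
      (a * a⁻¹) * u             ≡⟨ ≡.cong (_* u) (*-inverseʳ a a≢0) ⟩
      1# * u                    ≡⟨ *-identityˡ u ⟩
      u                         ∎
    right : ∀ y → a * (a⁻¹ * (y - b)) + b ≡ y
    right y = begin
      a * (a⁻¹ * (y - b)) + b   ≡⟨ solve 4 (λ a a⁻¹ y b → a :* (a⁻¹ :* (y :- b)) :+ b := (a :* a⁻¹) :* (y :- b) :+ b) ≡.refl a a⁻¹ y b ⟩
      (a * a⁻¹) * (y - b) + b   ≡⟨ ≡.cong (λ t → t * (y - b) + b) (*-inverseʳ a a≢0) ⟩
      1# * (y - b) + b          ≡⟨ solve 2 (λ y b → con (+ 1) :* (y :- b) :+ b := y) ≡.refl y b ⟩
      y                         ∎

module Squares (F : FiniteField) (two≢0 : FieldArithmetic.two F ≢ FiniteField.0# F) where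
  open FiniteField F
  open FieldArithmetic F
  open FieldSums F
  open ≡-Reasoning

  δ : Carrier → Carrier → ℕ
  δ x y = indicator (x ≟ y)

  -- isSquare counts 0 as a square, unlike χ.
  isSquare isZero roots : Carrier → ℕ
  isSquare x = indicator (isSquare? x)
  isZero x = δ x 0#
  roots x = ∑ (λ u → δ (u * u) x)

  ≢-negation : ∀ {w} → w ≢ 0# → w ≢ - w
  ≢-negation {w} w≢0 w≡-w = w≢0 (*-≡0-cancelˡ two≢0 (begin
    two * w       ≡⟨ solve 1 (λ w → con (+ 2) :* w := w :+ w) ≡.refl w ⟩
    w + w         ≡⟨ ≡.cong (_+_ w) w≡-w ⟩
    w + - w       ≡⟨ -‿inverseʳ w ⟩
    0#            ∎))

  roots-0 : roots 0# ≡ 1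
  roots-0 = ≡.trans (∑-single _ 0# (λ u u≢0 → indicator-no ((u * u) ≟ 0#) (u≢0 ∘ square≡0⇒≡0)))
                    (indicator-yes ((0# * 0#) ≟ 0#) (zeroˡ 0#))

  roots-square : ∀ {w} → w ≢ 0# → roots (w * w) ≡ 2
  roots-square {w} w≢0 = begin
    roots (w * w)                             ≡⟨ ∑-cong two-roots ⟩
    ∑ (λ u → δ u w ℕ.+ δ u (- w))            ≡⟨ ∑-+ (λ u → δ u w) (λ u → δ u (- w)) ⟩
    ∑ (λ u → δ u w) ℕ.+ ∑ (λ u → δ u (- w))  ≡⟨ ≡.cong₂ ℕ._+_ (∑-indicator-≡ _≟_ w) (∑-indicator-≡ _≟_ (- w)) ⟩
    2                                         ∎
    where
    two-roots : ∀ u → δ (u * u) (w * w) ≡ δ u w ℕ.+ δ u (- w)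
    two-roots u with u ≟ w | u ≟ (- w)
    ... | yes u≡w | yes u≡-w = contradiction (≡.trans (≡.sym u≡w) u≡-w) (≢-negation w≢0)
    ... | yes ≡.refl | no _ = indicator-yes ((u * u) ≟ (u * u)) ≡.refl
    ... | no _ | yes ≡.refl = indicator-yes ((- w * - w) ≟ (w * w)) (solve 1 (λ w → (:- w) :* (:- w) := w :* w) ≡.refl w)
    ... | no u≢w | no u≢-w = indicator-no ((u * u) ≟ (w * w)) ([ u≢w , u≢-w ] ∘ square-injective)

  roots-nonsquare : ∀ {x} → ¬ IsSquare x → roots x ≡ 0
  roots-nonsquare {x} ¬□x = ≡.trans (∑-cong (λ u → indicator-no ((u * u) ≟ x) (λ uu≡x → ¬□x (u , uu≡x))))
                                    ∑-0

  roots+isZero : ∀ x → roots x ℕ.+ isZero x ≡ 2 ℕ.* isSquare x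
  roots+isZero x with x ≟ 0# | isSquare? x
  ... | yes ≡.refl | yes _ = ≡.cong (ℕ._+ 1) roots-0
  ... | yes ≡.refl | no ¬□0 = contradiction IsSquare-0 ¬□0
  ... | no x≢0 | yes (w , ≡.refl) = ≡.cong (ℕ._+ 0) (roots-square (λ w≡0 → x≢0 (≡.trans (≡.cong (λ w → w * w) w≡0) (zeroˡ 0#))))
  ... | no _ | no ¬□x = ≡.cong (ℕ._+ 0) (roots-nonsquare ¬□x)

  ∑-isZero : ∑ isZero ≡ 1
  ∑-isZero = ∑-indicator-≡ _≟_ 0#

  ∑-roots : ∑ roots ≡ q
  ∑-roots = begin
    ∑ (λ x → ∑ (λ u → δ (u * u) x))   ≡⟨ ∑-comm (λ x u → δ (u * u) x) ⟩
    ∑ (λ u → ∑ (λ x → δ (u * u) x))   ≡⟨ ∑-cong (λ u → ∑-indicator-≡′ _≟_ (u * u)) ⟩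
    ∑ (λ _ → 1)                        ≡⟨ ∑-1 ⟩
    q                                  ∎

  2*∑-isSquare : 2 ℕ.* ∑ isSquare ≡ q ℕ.+ 1
  2*∑-isSquare = begin
    2 ℕ.* ∑ isSquare                    ≡⟨ ∑-*ˡ 2 isSquare ⟨
    ∑ (λ x → 2 ℕ.* isSquare x)          ≡⟨ ∑-cong roots+isZero ⟨
    ∑ (λ x → roots x ℕ.+ isZero x)      ≡⟨ ∑-+ roots isZero ⟩
    ∑ roots ℕ.+ ∑ isZero                ≡⟨ ≡.cong₂ ℕ._+_ ∑-roots ∑-isZero ⟩
    q ℕ.+ 1                             ∎

  roots≡2*isSquare : ∀ {y} → y ≢ 0# → roots y ≡ 2 ℕ.* isSquare y
  roots≡2*isSquare {y} y≢0 = ≡.trans (≡.sym (≡.trans (≡.cong (roots y ℕ.+_) (indicator-no (y ≟ 0#) y≢0)) (ℕₚ.+-identityʳ _)))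
                                     (roots+isZero y)

  isZero-+ : ∀ x c → isZero (x + c) ≡ δ x (- c)
  isZero-+ x c = indicator-cong ((x + c) ≟ 0#) (x ≟ (- c)) (inverseˡ-unique x c) (λ x≡-c → ≡.trans (≡.cong (_+ c) x≡-c) (-‿inverseˡ c))

  module _ {c : Carrier} (c≢0 : c ≢ 0#) where

    roots-shifted-square : ∀ u → roots (u * u + c) ≡ ∑ (λ w → δ (w * (two * u + w)) c)
    roots-shifted-square u = begin
      ∑ (λ v → δ (v * v) (u * u + c))                         ≡⟨ ∑-affine u 1≢0 (λ v → δ (v * v) (u * u + c)) ⟨
      ∑ (λ w → δ ((1# * w + u) * (1# * w + u)) (u * u + c))   ≡⟨ ∑-cong (λ w → indicator-cong (_ ≟ _) (_ ≟ _) (⇒ w) (⇐ w)) ⟩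
      ∑ (λ w → δ (w * (two * u + w)) c)                       ∎
      where
      expand : ∀ w → (1# * w + u) * (1# * w + u) ≡ w * (two * u + w) + u * u
      expand w = solve 2 (λ w u → (con (+ 1) :* w :+ u) :* (con (+ 1) :* w :+ u) := w :* (con (+ 2) :* u :+ w) :+ u :* u) ≡.refl w u
      ⇒ : ∀ w → (1# * w + u) * (1# * w + u) ≡ u * u + c → w * (two * u + w) ≡ c
      ⇒ w eq = ∙-cancelʳ (u * u) _ c (≡.trans (≡.sym (expand w)) (≡.trans eq (+-comm (u * u) c)))
      ⇐ : ∀ w → w * (two * u + w) ≡ c → (1# * w + u) * (1# * w + u) ≡ u * u + c
      ⇐ w eq = ≡.trans (expand w) (≡.trans (≡.cong (_+ u * u) eq) (+-comm c (u * u)))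

    solutions+isZero : ∀ w → ∑ (λ u → δ (w * (two * u + w)) c) ℕ.+ isZero w ≡ 1
    solutions+isZero w with w ≟ 0#
    ... | yes ≡.refl = ≡.cong (ℕ._+ 1) (≡.trans (∑-cong (λ u → indicator-no ((0# * (two * u + 0#)) ≟ c) (λ eq → c≢0 (≡.trans (≡.sym eq) (zeroˡ _)))))
                                                 ∑-0)
    ... | no w≢0 = ≡.trans (ℕₚ.+-identityʳ _) (begin
      ∑ (λ u → δ (w * (two * u + w)) c)               ≡⟨ ∑-cong (λ u → ≡.cong (λ y → δ y c) (solve 3 (λ w t u → w :* (t :* u :+ w) := (t :* w) :* u :+ w :* w) ≡.refl w two u)) ⟩
      ∑ (λ u → δ ((two * w) * u + w * w) c)           ≡⟨ ∑-affine (w * w) (*-≢0 two≢0 w≢0) (λ y → δ y c) ⟩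
      ∑ (λ y → δ y c)                                 ≡⟨ ∑-indicator-≡ _≟_ c ⟩
      1                                               ∎)

    -- The sum counts the solutions of v² - u² = c. Substituting v = u + w makes the equation
    -- w (2u + w) = c linear in u, with exactly one solution for each w ≠ 0.
    ∑-roots*roots-shifted : ∑ (λ x → roots x ℕ.* roots (x + c)) ℕ.+ 1 ≡ q
    ∑-roots*roots-shifted = begin
      ∑ (λ x → roots x ℕ.* roots (x + c)) ℕ.+ 1                          ≡⟨ ≡.cong₂ ℕ._+_ pairs (≡.sym ∑-isZero) ⟩
      ∑ (λ w → ∑ (λ u → δ (w * (two * u + w)) c)) ℕ.+ ∑ isZero            ≡⟨ ∑-+ (λ w → ∑ (λ u → δ (w * (two * u + w)) c)) isZero ⟨
      ∑ (λ w → ∑ (λ u → δ (w * (two * u + w)) c) ℕ.+ isZero w)           ≡⟨ ∑-cong solutions+isZero ⟩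
      ∑ (λ _ → 1)                                                        ≡⟨ ∑-1 ⟩
      q                                                                  ∎
      where
      pairs : ∑ (λ x → roots x ℕ.* roots (x + c)) ≡ ∑ (λ w → ∑ (λ u → δ (w * (two * u + w)) c))
      pairs = begin
        ∑ (λ x → roots x ℕ.* roots (x + c))                    ≡⟨ ∑-cong (λ x → ∑-*ʳ (λ u → δ (u * u) x) (roots (x + c))) ⟩
        ∑ (λ x → ∑ (λ u → δ (u * u) x ℕ.* roots (x + c)))      ≡⟨ ∑-comm (λ x u → δ (u * u) x ℕ.* roots (x + c)) ⟩
        ∑ (λ u → ∑ (λ x → δ (u * u) x ℕ.* roots (x + c)))      ≡⟨ ∑-cong (λ u → ∑-indicator-* _≟_ (u * u) (λ x → roots (x + c))) ⟩
        ∑ (λ u → roots (u * u + c))                            ≡⟨ ∑-cong roots-shifted-square ⟩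
        ∑ (λ u → ∑ (λ w → δ (w * (two * u + w)) c))            ≡⟨ ∑-comm (λ u w → δ (w * (two * u + w)) c) ⟩
        ∑ (λ w → ∑ (λ u → δ (w * (two * u + w)) c))            ∎

    ∑-roots*isZero-shifted : ∑ (λ x → roots x ℕ.* isZero (x + c)) ≡ 2 ℕ.* isSquare (- c)
    ∑-roots*isZero-shifted = begin
      ∑ (λ x → roots x ℕ.* isZero (x + c))   ≡⟨ ∑-cong (λ x → ≡.trans (ℕₚ.*-comm (roots x) (isZero (x + c))) (≡.cong (ℕ._* roots x) (isZero-+ x c))) ⟩
      ∑ (λ x → δ x (- c) ℕ.* roots x)        ≡⟨ ∑-indicator-*′ _≟_ (- c) roots ⟩
      roots (- c)                            ≡⟨ roots≡2*isSquare {y = - c} (-‿≢0 {x = c} c≢0) ⟩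
      2 ℕ.* isSquare (- c)                   ∎

    ∑-isZero*roots-shifted : ∑ (λ x → isZero x ℕ.* roots (x + c)) ≡ 2 ℕ.* isSquare c
    ∑-isZero*roots-shifted = ≡.trans (∑-indicator-*′ _≟_ 0# (λ x → roots (x + c)))
                                     (≡.trans (≡.cong roots (+-identityˡ c)) (roots≡2*isSquare c≢0))

    ∑-isZero*isZero-shifted : ∑ (λ x → isZero x ℕ.* isZero (x + c)) ≡ 0
    ∑-isZero*isZero-shifted = ≡.trans (∑-indicator-*′ _≟_ 0# (λ x → isZero (x + c)))
                                      (≡.trans (≡.cong isZero (+-identityˡ c)) (indicator-no (c ≟ 0#) c≢0))

    4*∑-isSquare*isSquare-shifted : 4 ℕ.* ∑ (λ x → isSquare x ℕ.* isSquare (x + c)) ℕ.+ 1 ≡ q ℕ.+ 2 ℕ.* isSquare (- c) ℕ.+ 2 ℕ.* isSquare c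
    4*∑-isSquare*isSquare-shifted = begin
      4 ℕ.* ∑ M ℕ.+ 1                                            ≡⟨ ≡.cong (ℕ._+ 1) (≡.trans (≡.sym (∑-*ˡ 4 M)) (∑-cong expand)) ⟩
      ∑ (λ x → RR x ℕ.+ RZ x ℕ.+ ZR x ℕ.+ ZZ x) ℕ.+ 1            ≡⟨ ≡.cong (ℕ._+ 1) ∑-split ⟩
      ∑ RR ℕ.+ ∑ RZ ℕ.+ ∑ ZR ℕ.+ ∑ ZZ ℕ.+ 1                      ≡⟨ rearrange (∑ RR) (∑ RZ) (∑ ZR) (∑ ZZ) ⟩
      (∑ RR ℕ.+ 1) ℕ.+ ∑ RZ ℕ.+ ∑ ZR ℕ.+ ∑ ZZ                    ≡⟨ ≡.cong₂ ℕ._+_ (≡.cong₂ ℕ._+_ (≡.cong₂ ℕ._+_ ∑-roots*roots-shifted ∑-roots*isZero-shifted)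
                                                                                                 ∑-isZero*roots-shifted) ∑-isZero*isZero-shifted ⟩
      q ℕ.+ 2 ℕ.* isSquare (- c) ℕ.+ 2 ℕ.* isSquare c ℕ.+ 0      ≡⟨ ℕₚ.+-identityʳ _ ⟩
      q ℕ.+ 2 ℕ.* isSquare (- c) ℕ.+ 2 ℕ.* isSquare c            ∎
      where
      M RR RZ ZR ZZ : Carrier → ℕ
      M x = isSquare x ℕ.* isSquare (x + c)
      RR x = roots x ℕ.* roots (x + c)
      RZ x = roots x ℕ.* isZero (x + c)
      ZR x = isZero x ℕ.* roots (x + c)
      ZZ x = isZero x ℕ.* isZero (x + c)
      expand : ∀ x → 4 ℕ.* M x ≡ RR x ℕ.+ RZ x ℕ.+ ZR x ℕ.+ ZZ x
      expand x = begin
        4 ℕ.* (isSquare x ℕ.* isSquare (x + c))                       ≡⟨ double-both (isSquare x) (isSquare (x + c)) ⟩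
        (2 ℕ.* isSquare x) ℕ.* (2 ℕ.* isSquare (x + c))               ≡⟨ ≡.cong₂ ℕ._*_ (roots+isZero x) (roots+isZero (x + c)) ⟨
        (roots x ℕ.+ isZero x) ℕ.* (roots (x + c) ℕ.+ isZero (x + c)) ≡⟨ foil (roots x) (isZero x) (roots (x + c)) (isZero (x + c)) ⟩
        RR x ℕ.+ RZ x ℕ.+ ZR x ℕ.+ ZZ x                               ∎
        where
        double-both : ∀ a b → 4 ℕ.* (a ℕ.* b) ≡ (2 ℕ.* a) ℕ.* (2 ℕ.* b)
        double-both = ℕ-Solver.solve-∀
        foil : ∀ a b c d → (a ℕ.+ b) ℕ.* (c ℕ.+ d) ≡ a ℕ.* c ℕ.+ a ℕ.* d ℕ.+ b ℕ.* c ℕ.+ b ℕ.* d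
        foil = ℕ-Solver.solve-∀
      ∑-split : ∑ (λ x → RR x ℕ.+ RZ x ℕ.+ ZR x ℕ.+ ZZ x) ≡ ∑ RR ℕ.+ ∑ RZ ℕ.+ ∑ ZR ℕ.+ ∑ ZZ
      ∑-split = ≡.trans (∑-+ (λ x → RR x ℕ.+ RZ x ℕ.+ ZR x) ZZ)
                (≡.cong (ℕ._+ ∑ ZZ) (≡.trans (∑-+ (λ x → RR x ℕ.+ RZ x) ZR) (≡.cong (ℕ._+ ∑ ZR) (∑-+ RR RZ))))
      rearrange : ∀ a b c d → a ℕ.+ b ℕ.+ c ℕ.+ d ℕ.+ 1 ≡ (a ℕ.+ 1) ℕ.+ b ℕ.+ c ℕ.+ d
      rearrange = ℕ-Solver.solve-∀

  nonzeroSquare nonSquare : Carrier → ℕ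
  nonzeroSquare x = isSquare x ℕ.∸ isZero x
  nonSquare x = 1 ℕ.∸ isSquare x

  nonzeroSquare-0 : nonzeroSquare 0# ≡ 0
  nonzeroSquare-0 = ≡.cong₂ ℕ._∸_ (indicator-yes (isSquare? 0#) IsSquare-0) (indicator-yes (0# ≟ 0#) ≡.refl)

  nonzeroSquare-¬□ : ∀ {x} → ¬ IsSquare x → nonzeroSquare x ≡ 0
  nonzeroSquare-¬□ {x} ¬□x = ≡.trans (≡.cong (ℕ._∸ isZero x) (indicator-no (isSquare? x) ¬□x)) (ℕₚ.0∸n≡0 (isZero x))

  nonzeroSquare-□ : ∀ {x} → x ≢ 0# → IsSquare x → nonzeroSquare x ≡ 1
  nonzeroSquare-□ {x} x≢0 □x = ≡.cong₂ ℕ._∸_ (indicator-yes (isSquare? x) □x) (indicator-no (x ≟ 0#) x≢0)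

  nonSquare-□ : ∀ {x} → IsSquare x → nonSquare x ≡ 0
  nonSquare-□ {x} □x = ≡.cong (1 ℕ.∸_) (indicator-yes (isSquare? x) □x)

  nonSquare-¬□ : ∀ {x} → ¬ IsSquare x → nonSquare x ≡ 1
  nonSquare-¬□ {x} ¬□x = ≡.cong (1 ℕ.∸_) (indicator-no (isSquare? x) ¬□x)

  nonzeroSquare*nonSquare : ∀ x y → nonzeroSquare x ℕ.* nonSquare y ℕ.+ isSquare x ℕ.* isSquare y ℕ.+ isZero x
                                    ≡ isSquare x ℕ.+ isZero x ℕ.* isSquare y
  nonzeroSquare*nonSquare x y with x ≟ 0# | isSquare? x | isSquare? y
  ... | yes ≡.refl | no ¬□0 | _ = contradiction IsSquare-0 ¬□0
  ... | yes ≡.refl | yes _ | yes _ = ≡.refl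
  ... | yes ≡.refl | yes _ | no _ = ≡.refl
  ... | no _ | yes _ | yes _ = ≡.refl
  ... | no _ | yes _ | no _ = ≡.refl
  ... | no _ | no _ | _ = ≡.refl

  ∑-nonzeroSquare*nonSquare-shifted : ∀ c →
    ∑ (λ x → nonzeroSquare x ℕ.* nonSquare (x + c)) ℕ.+ ∑ (λ x → isSquare x ℕ.* isSquare (x + c)) ℕ.+ 1
    ≡ ∑ isSquare ℕ.+ isSquare c
  ∑-nonzeroSquare*nonSquare-shifted c = begin
    ∑ N ℕ.+ ∑ M ℕ.+ 1                        ≡⟨ ≡.cong (∑ N ℕ.+ ∑ M ℕ.+_) ∑-isZero ⟨
    ∑ N ℕ.+ ∑ M ℕ.+ ∑ isZero                 ≡⟨ ≡.cong (ℕ._+ ∑ isZero) (∑-+ N M) ⟨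
    ∑ (λ x → N x ℕ.+ M x) ℕ.+ ∑ isZero       ≡⟨ ∑-+ (λ x → N x ℕ.+ M x) isZero ⟨
    ∑ (λ x → N x ℕ.+ M x ℕ.+ isZero x)       ≡⟨ ∑-cong (λ x → nonzeroSquare*nonSquare x (x + c)) ⟩
    ∑ (λ x → isSquare x ℕ.+ Z x)             ≡⟨ ∑-+ isSquare Z ⟩
    ∑ isSquare ℕ.+ ∑ Z                       ≡⟨ ≡.cong (∑ isSquare ℕ.+_) (∑-indicator-*′ _≟_ 0# (λ x → isSquare (x + c))) ⟩
    ∑ isSquare ℕ.+ isSquare (0# + c)         ≡⟨ ≡.cong (λ t → ∑ isSquare ℕ.+ isSquare t) (+-identityˡ c) ⟩
    ∑ isSquare ℕ.+ isSquare c                ∎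
    where
    N M Z : Carrier → ℕ
    N x = nonzeroSquare x ℕ.* nonSquare (x + c)
    M x = isSquare x ℕ.* isSquare (x + c)
    Z x = isZero x ℕ.* isSquare (x + c)

module NonSquareMultiples (F : FiniteField) (two≢0 : FieldArithmetic.two F ≢ FiniteField.0# F)
                          {ν : FiniteField.Carrier F} (¬□ν : ¬ FiniteField.IsSquare F ν) where
  open FiniteField F
  open FieldArithmetic F
  open FieldSums F
  open Squares F two≢0
  open ≡-Reasoning

  ν≢0 : ν ≢ 0#
  ν≢0 ν≡0 = ¬□ν (≡.subst IsSquare (≡.sym ν≡0) IsSquare-0)

  □⇒¬□-ν* : ∀ {x} → x ≢ 0# → IsSquare x → ¬ IsSquare (ν * x)
  □⇒¬□-ν* {x} x≢0 (w , ww≡x) (v , vv≡νx) = ¬□ν (v * w⁻¹ , (begin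
    (v * w⁻¹) * (v * w⁻¹)         ≡⟨ solve 2 (λ v w⁻¹ → (v :* w⁻¹) :* (v :* w⁻¹) := (v :* v) :* (w⁻¹ :* w⁻¹)) ≡.refl v w⁻¹ ⟩
    (v * v) * (w⁻¹ * w⁻¹)         ≡⟨ ≡.cong (_* (w⁻¹ * w⁻¹)) (≡.trans vv≡νx (≡.cong (ν *_) (≡.sym ww≡x))) ⟩
    (ν * (w * w)) * (w⁻¹ * w⁻¹)   ≡⟨ solve 3 (λ ν w w⁻¹ → (ν :* (w :* w)) :* (w⁻¹ :* w⁻¹) := ν :* ((w :* w⁻¹) :* (w :* w⁻¹))) ≡.refl ν w w⁻¹ ⟩
    ν * ((w * w⁻¹) * (w * w⁻¹))   ≡⟨ ≡.cong (λ t → ν * (t * t)) (*-inverseʳ w w≢0) ⟩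
    ν * (1# * 1#)                 ≡⟨ solve 1 (λ ν → ν :* (con (+ 1) :* con (+ 1)) := ν) ≡.refl ν ⟩
    ν                             ∎))
    where
    w≢0 : w ≢ 0#
    w≢0 w≡0 = x≢0 (≡.trans (≡.sym ww≡x) (≡.trans (≡.cong (λ t → t * t) w≡0) (zeroˡ 0#)))
    w⁻¹ = w ⁻¹⟨ w≢0 ⟩

  isSquare+isSquare-ν*≤ : ∀ x → isSquare x ℕ.+ isSquare (ν * x) ℕ.≤ 1 ℕ.+ isZero x
  isSquare+isSquare-ν*≤ x with x ≟ 0# | isSquare? x
  ... | yes _ | □x? = ℕₚ.+-mono-≤ (indicator≤1 □x?) (indicator≤1 (isSquare? (ν * x)))
  ... | no _ | no _ = indicator≤1 (isSquare? (ν * x))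
  ... | no x≢0 | yes □x = ℕₚ.≤-reflexive (≡.cong suc (indicator-no (isSquare? (ν * x)) (□⇒¬□-ν* x≢0 □x)))

  -- The pointwise bound is an equality because both sides sum to q + 1.
  isSquare+isSquare-ν* : ∀ x → isSquare x ℕ.+ isSquare (ν * x) ≡ 1 ℕ.+ isZero x
  isSquare+isSquare-ν* = ∑-mono-≡⇒≗ _ (λ x → 1 ℕ.+ isZero x) isSquare+isSquare-ν*≤ (begin
    ∑ (λ x → isSquare x ℕ.+ isSquare (ν * x))   ≡⟨ ∑-+ isSquare (λ x → isSquare (ν * x)) ⟩
    ∑ isSquare ℕ.+ ∑ (λ x → isSquare (ν * x))   ≡⟨ ≡.cong (∑ isSquare ℕ.+_) ∑-isSquare-ν* ⟩
    ∑ isSquare ℕ.+ ∑ isSquare                   ≡⟨ ≡.cong (∑ isSquare ℕ.+_) (ℕₚ.+-identityʳ (∑ isSquare)) ⟨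
    2 ℕ.* ∑ isSquare                            ≡⟨ 2*∑-isSquare ⟩
    q ℕ.+ 1                                     ≡⟨ ≡.cong₂ ℕ._+_ ∑-1 ∑-isZero ⟨
    ∑ (λ _ → 1) ℕ.+ ∑ isZero                    ≡⟨ ∑-+ (λ _ → 1) isZero ⟨
    ∑ (λ x → 1 ℕ.+ isZero x)                    ∎)
    where
    ∑-isSquare-ν* : ∑ (λ x → isSquare (ν * x)) ≡ ∑ isSquare
    ∑-isSquare-ν* = ≡.trans (∑-cong (λ x → ≡.cong isSquare (≡.sym (+-identityʳ (ν * x))))) (∑-affine 0# ν≢0 isSquare)

  ¬□⇒□-ν* : ∀ {x} → x ≢ 0# → ¬ IsSquare x → IsSquare (ν * x)
  ¬□⇒□-ν* {x} x≢0 ¬□x = indicator≡1⇒ (isSquare? (ν * x)) (begin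
    isSquare (ν * x)                  ≡⟨ ≡.cong (ℕ._+ isSquare (ν * x)) (indicator-no (isSquare? x) ¬□x) ⟨
    isSquare x ℕ.+ isSquare (ν * x)   ≡⟨ isSquare+isSquare-ν* x ⟩
    1 ℕ.+ isZero x                    ≡⟨ ≡.cong (1 ℕ.+_) (indicator-no (x ≟ 0#) x≢0) ⟩
    1                                 ∎)

module FixedVertices (F : FiniteField) (two≢0 : FieldArithmetic.two F ≢ FiniteField.0# F) where
  open FiniteField F
  open FieldArithmetic F
  open ≡-Reasoning

  IsRoot : Carrier → Carrier → Carrier → Set
  IsRoot k a x = k * (x * x) - (x + a) ≡ 0#

  complete-square : ∀ k a x → (two * k * x - 1#) * (two * k * x - 1#) ≡ four * k * (k * (x * x) - (x + a)) + (1# + four * (k * a))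
  complete-square = solve 3 (λ k a x → (con (+ 2) :* k :* x :- con (+ 1)) :* (con (+ 2) :* k :* x :- con (+ 1))
                                      := con (+ 4) :* k :* (k :* (x :* x) :- (x :+ a)) :+ (con (+ 1) :+ con (+ 4) :* (k :* a))) ≡.refl

  root⇒discriminant-square : ∀ {k a x} → IsRoot k a x → IsSquare (1# + four * (k * a))
  root⇒discriminant-square {k} {a} {x} root = two * k * x - 1# , (begin
    (two * k * x - 1#) * (two * k * x - 1#)                  ≡⟨ complete-square k a x ⟩
    four * k * (k * (x * x) - (x + a)) + (1# + four * (k * a)) ≡⟨ ≡.cong (λ t → four * k * t + (1# + four * (k * a))) root ⟩
    four * k * 0# + (1# + four * (k * a))                    ≡⟨ solve 2 (λ k d → con (+ 4) :* k :* con (+ 0) :+ d := d) ≡.refl k (1# + four * (k * a)) ⟩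
    1# + four * (k * a)                                      ∎)

  discriminant-square⇒root : ∀ {k a} → k ≢ 0# → IsSquare (1# + four * (k * a)) → ∃ (IsRoot k a)
  discriminant-square⇒root {k} {a} k≢0 (y , yy≡d) = x , *-≡0-cancelˡ 4k≢0 (begin
    four * k * (k * (x * x) - (x + a))                         ≡⟨ solve 2 (λ e d → e := (e :+ d) :- d) ≡.refl _ d ⟩
    four * k * (k * (x * x) - (x + a)) + d - d                 ≡⟨ ≡.cong (_- d) (complete-square k a x) ⟨
    (two * k * x - 1#) * (two * k * x - 1#) - d                ≡⟨ ≡.cong (λ t → t * t - d) 2kx-1≡y ⟩
    y * y - d                                                  ≡⟨ ≡.cong (_- d) yy≡d ⟩
    d - d                                                      ≡⟨ -‿inverseʳ d ⟩
    0#                                                         ∎)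
    where
    d = 1# + four * (k * a)
    2k≢0 : two * k ≢ 0#
    2k≢0 = *-≢0 two≢0 k≢0
    4k≢0 : four * k ≢ 0#
    4k≢0 = ≡.subst (_≢ 0#) (solve 1 (λ k → con (+ 2) :* (con (+ 2) :* k) := con (+ 4) :* k) ≡.refl k) (*-≢0 two≢0 2k≢0)
    x = (y + 1#) * (two * k) ⁻¹⟨ 2k≢0 ⟩
    2kx-1≡y : two * k * x - 1# ≡ y
    2kx-1≡y = begin
      two * k * ((y + 1#) * (two * k) ⁻¹⟨ 2k≢0 ⟩) - 1#         ≡⟨ solve 3 (λ t y s → t :* ((y :+ con (+ 1)) :* s) :- con (+ 1) := (t :* s) :* (y :+ con (+ 1)) :- con (+ 1)) ≡.refl (two * k) y _ ⟩
      (two * k * (two * k) ⁻¹⟨ 2k≢0 ⟩) * (y + 1#) - 1#         ≡⟨ ≡.cong (λ t → t * (y + 1#) - 1#) (*-inverseʳ (two * k) 2k≢0) ⟩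
      1# * (y + 1#) - 1#                                       ≡⟨ solve 1 (λ y → con (+ 1) :* (y :+ con (+ 1)) :- con (+ 1) := y) ≡.refl y ⟩
      y                                                        ∎

  IsRoot-1⇒ : ∀ {a x} → IsRoot 1# a x → x * x - (x + a) ≡ 0#
  IsRoot-1⇒ {a} {x} = ≡.trans (≡.cong (_- (x + a)) (≡.sym (*-identityˡ (x * x))))

  IsRoot-1⇐ : ∀ {a x} → x * x - (x + a) ≡ 0# → IsRoot 1# a x
  IsRoot-1⇐ {a} {x} = ≡.trans (≡.cong (_- (x + a)) (*-identityˡ (x * x)))

  discriminant-1 : ∀ a → 1# + four * (1# * a) ≡ 1# + four * a
  discriminant-1 a = ≡.cong (λ t → 1# + four * t) (*-identityˡ a)

  hasFixedVertex⇒ : ∀ {μ} a → HasFixedVertex F μ (λ x → x + a) → IsSquare (1# + four * a) ⊎ IsSquare (1# + four * (μ * a))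
  hasFixedVertex⇒ a (x , loop) = Sum.map
    (λ root → ≡.subst IsSquare (discriminant-1 a) (root⇒discriminant-square (IsRoot-1⇐ root)))
    root⇒discriminant-square
    (*-≡0 loop)

  hasFixedVertex⇐ : ∀ {μ} a → μ ≢ 0# → IsSquare (1# + four * a) ⊎ IsSquare (1# + four * (μ * a)) → HasFixedVertex F μ (λ x → x + a)
  hasFixedVertex⇐ {μ} a _ (inj₁ □) = Product.map₂ first-factor
    (discriminant-square⇒root {1#} {a} 1≢0 (≡.subst IsSquare (≡.sym (discriminant-1 a)) □))
    where
    first-factor : ∀ {x} → IsRoot 1# a x → (x * x - (x + a)) * (μ * (x * x) - (x + a)) ≡ 0#
    first-factor {x} root = ≡.trans (≡.cong (_* (μ * (x * x) - (x + a))) (IsRoot-1⇒ root)) (zeroˡ (μ * (x * x) - (x + a)))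
  hasFixedVertex⇐ {μ} a μ≢0 (inj₂ □) = Product.map₂ second-factor (discriminant-square⇒root {μ} {a} μ≢0 □)
    where
    second-factor : ∀ {x} → IsRoot μ a x → (x * x - (x + a)) * (μ * (x * x) - (x + a)) ≡ 0#
    second-factor {x} root = ≡.trans (≡.cong (_*_ (x * x - (x + a))) root) (zeroʳ (x * x - (x + a)))

module FixedVertexCount (F : FiniteField) (two≢0 : FieldArithmetic.two F ≢ FiniteField.0# F)
                        {μ : FiniteField.Carrier F} (¬□μ : ¬ FiniteField.IsSquare F μ) where
  open FiniteField F
  open FieldArithmetic F
  open FieldSums F
  open Squares F two≢0
  open NonSquareMultiples F two≢0 ¬□μ renaming (ν≢0 to μ≢0)
  open FixedVertices F two≢0
  open ≡-Reasoning

  c : Carrier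
  c = 1# - μ

  c≢0 : c ≢ 0#
  c≢0 c≡0 = ¬□μ (1# , ≡.trans (*-identityˡ 1#) (x∙y⁻¹≈ε⇒x≈y 1# μ c≡0))

  excluded : Carrier → ℕ
  excluded x = nonzeroSquare x ℕ.* nonSquare (x + c)

  -- a ↦ π a = μ (1 + 4a) carries the complement of S onto the support of excluded.
  π : Carrier → Carrier
  π a = four * μ * a + μ

  π-discriminant : ∀ a → π a ≡ μ * (1# + four * a)
  π-discriminant = solve 2 (λ μ a → con (+ 4) :* μ :* a :+ μ := μ :* (con (+ 1) :+ con (+ 4) :* a)) ≡.refl μ

  π-shifted : ∀ a → π a + c ≡ 1# + four * (μ * a)
  π-shifted = solve 2 (λ μ a → con (+ 4) :* μ :* a :+ μ :+ (con (+ 1) :- μ) := con (+ 1) :+ con (+ 4) :* (μ :* a)) ≡.refl μ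

  excluded-fixed : ∀ {a} → IsSquare (1# + four * a) ⊎ IsSquare (1# + four * (μ * a)) → excluded (π a) ≡ 0
  excluded-fixed {a} (inj₂ □) = ≡.trans (≡.cong (nonzeroSquare (π a) ℕ.*_) (nonSquare-□ (≡.subst IsSquare (≡.sym (π-shifted a)) □)))
                                        (ℕₚ.*-zeroʳ (nonzeroSquare (π a)))
  excluded-fixed {a} (inj₁ □) = ≡.cong (ℕ._* nonSquare (π a + c)) nonzero-square
    where
    nonzero-square : nonzeroSquare (π a) ≡ 0
    nonzero-square with (1# + four * a) ≟ 0#
    ... | yes y≡0 = ≡.trans (≡.cong nonzeroSquare (≡.trans (π-discriminant a) (≡.trans (≡.cong (μ *_) y≡0) (zeroʳ μ)))) nonzeroSquare-0
    ... | no y≢0 = nonzeroSquare-¬□ (≡.subst (¬_ ∘ IsSquare) (≡.sym (π-discriminant a)) (□⇒¬□-ν* y≢0 □))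

  excluded-¬fixed : ∀ {a} → ¬ HasFixedVertex F μ (λ x → x + a) → excluded (π a) ≡ 1
  excluded-¬fixed {a} ¬fixed = ≡.cong₂ ℕ._*_ (nonzeroSquare-□ πa≢0 □πa) (nonSquare-¬□ ¬□πa+c)
    where
    ¬□y : ¬ IsSquare (1# + four * a)
    ¬□y □ = ¬fixed (hasFixedVertex⇐ a μ≢0 (inj₁ □))
    y≢0 : 1# + four * a ≢ 0#
    y≢0 y≡0 = ¬□y (≡.subst IsSquare (≡.sym y≡0) IsSquare-0)
    πa≢0 : π a ≢ 0#
    πa≢0 = ≡.subst (_≢ 0#) (≡.sym (π-discriminant a)) (*-≢0 μ≢0 y≢0)
    □πa : IsSquare (π a)
    □πa = ≡.subst IsSquare (≡.sym (π-discriminant a)) (¬□⇒□-ν* y≢0 ¬□y)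
    ¬□πa+c : ¬ IsSquare (π a + c)
    ¬□πa+c □ = ¬fixed (hasFixedVertex⇐ a μ≢0 (inj₂ (≡.subst IsSquare (π-shifted a) □)))

  inS+excluded : ∀ a → indicator (S? F μ a) ℕ.+ excluded (π a) ≡ 1
  inS+excluded a with S? F μ a
  ... | yes fixed = ≡.cong suc (excluded-fixed (hasFixedVertex⇒ a fixed))
  ... | no ¬fixed = excluded-¬fixed ¬fixed

  cardS+∑excluded : cardS F μ ℕ.+ ∑ excluded ≡ q
  cardS+∑excluded = begin
    cardS F μ ℕ.+ ∑ excluded                          ≡⟨ ≡.cong₂ ℕ._+_ (length-filter (S? F μ)) (≡.sym (∑-affine μ 4μ≢0 excluded)) ⟩
    ∑ (λ a → indicator (S? F μ a)) ℕ.+ ∑ (excluded ∘ π) ≡⟨ ∑-+ (λ a → indicator (S? F μ a)) (excluded ∘ π) ⟨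
    ∑ (λ a → indicator (S? F μ a) ℕ.+ excluded (π a))   ≡⟨ ∑-cong inS+excluded ⟩
    ∑ (λ _ → 1)                                       ≡⟨ ∑-1 ⟩
    q                                                 ∎
    where
    4μ≢0 : four * μ ≢ 0#
    4μ≢0 = ≡.subst (_≢ 0#) (solve 1 (λ μ → con (+ 2) :* (con (+ 2) :* μ) := con (+ 4) :* μ) ≡.refl μ) (*-≢0 two≢0 (*-≢0 two≢0 μ≢0))

  4*cardS+2*isSquare-c : 4 ℕ.* cardS F μ ℕ.+ 2 ℕ.* isSquare c ≡ 3 ℕ.* q ℕ.+ 1 ℕ.+ 2 ℕ.* isSquare (- c)
  4*cardS+2*isSquare-c = eliminate-N-M-E {M = ∑ (λ x → isSquare x ℕ.* isSquare (x + c))} {E = ∑ isSquare} {e₊ = isSquare c} {e₋ = isSquare (- c)}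
    cardS+∑excluded (∑-nonzeroSquare*nonSquare-shifted c) 2*∑-isSquare (4*∑-isSquare*isSquare-shifted c≢0)

module Consequences (F : FiniteField) (two≢0 : FieldArithmetic.two F ≢ FiniteField.0# F)
                    {μ : FiniteField.Carrier F} (¬□μ : ¬ FiniteField.IsSquare F μ) where
  open FiniteField F
  open FieldArithmetic F
  open Squares F two≢0
  open FixedVertexCount F two≢0 ¬□μ
  open ≡-Reasoning

  χ≡2*isSquare-1 : ∀ {x} → x ≢ 0# → χ x ≡ ℤ.+ (2 ℕ.* isSquare x) ℤ.- ℤ.+ 1
  χ≡2*isSquare-1 {x} x≢0 with x ≟ 0#
  ... | yes x≡0 = contradiction x≡0 x≢0
  ... | no _ with isSquare? x
  ...   | yes _ = ≡.refl
  ...   | no _ = ≡.refl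

  μ-1≡-c : μ - 1# ≡ - c
  μ-1≡-c = solve 1 (λ μ → μ :- con (ℤ.+ 1) := :- (con (ℤ.+ 1) :- μ)) ≡.refl μ

  4*cardS≡χ : ℤ.+ (4 ℕ.* cardS F μ) ≡ (ℤ.+ (3 ℕ.* q ℕ.+ 1) ℤ.+ χ (μ - 1#)) ℤ.- χ (1# - μ)
  4*cardS≡χ = begin
    ℤ.+ (4 ℕ.* cardS F μ)                                                        ≡⟨ move (4 ℕ.* cardS F μ) (2 ℕ.* isSquare c) (3 ℕ.* q ℕ.+ 1) (2 ℕ.* isSquare (- c)) 4*cardS+2*isSquare-c ⟩
    (ℤ.+ (3 ℕ.* q ℕ.+ 1) ℤ.+ (ℤ.+ (2 ℕ.* isSquare (- c)) ℤ.- ℤ.+ 1)) ℤ.- (ℤ.+ (2 ℕ.* isSquare c) ℤ.- ℤ.+ 1)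
                                                                                 ≡⟨ ≡.cong₂ (λ s t → (ℤ.+ (3 ℕ.* q ℕ.+ 1) ℤ.+ s) ℤ.- t)
                                                                                      (≡.trans (≡.sym (χ≡2*isSquare-1 (-‿≢0 c≢0))) (≡.cong χ (≡.sym μ-1≡-c)))
                                                                                      (≡.sym (χ≡2*isSquare-1 c≢0)) ⟩
    (ℤ.+ (3 ℕ.* q ℕ.+ 1) ℤ.+ χ (μ - 1#)) ℤ.- χ (1# - μ)                          ∎
    where
    move : ∀ a b c d → a ℕ.+ b ≡ c ℕ.+ d → ℤ.+ a ≡ (ℤ.+ c ℤ.+ (ℤ.+ d ℤ.- ℤ.+ 1)) ℤ.- (ℤ.+ b ℤ.- ℤ.+ 1)
    move a b c d a+b≡c+d = begin
      ℤ.+ a                                                ≡⟨ ℤ-identity₁ (ℤ.+ a) (ℤ.+ b) ⟩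
      (ℤ.+ a ℤ.+ ℤ.+ b) ℤ.- ℤ.+ b                          ≡⟨ ≡.cong (ℤ._- ℤ.+ b) (≡.trans (≡.sym (ℤₚ.pos-+ a b)) (≡.trans (≡.cong ℤ.+_ a+b≡c+d) (ℤₚ.pos-+ c d))) ⟩
      (ℤ.+ c ℤ.+ ℤ.+ d) ℤ.- ℤ.+ b                          ≡⟨ ℤ-identity₂ (ℤ.+ b) (ℤ.+ c) (ℤ.+ d) ⟩
      (ℤ.+ c ℤ.+ (ℤ.+ d ℤ.- ℤ.+ 1)) ℤ.- (ℤ.+ b ℤ.- ℤ.+ 1)  ∎
      where
      ℤ-identity₁ : ∀ a b → a ≡ (a ℤ.+ b) ℤ.- b
      ℤ-identity₁ = ℤ-Solver.solve-∀
      ℤ-identity₂ : ∀ b c d → (c ℤ.+ d) ℤ.- b ≡ (c ℤ.+ (d ℤ.- ℤ.+ 1)) ℤ.- (b ℤ.- ℤ.+ 1)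
      ℤ-identity₂ = ℤ-Solver.solve-∀

  isSquare-c≡isSquare-[-c] : IsSquare (- 1#) → isSquare c ≡ isSquare (- c)
  isSquare-c≡isSquare-[-c] □-1 = indicator-cong (isSquare? c) (isSquare? (- c))
    (≡.subst IsSquare (solve 1 (λ c → :- con (ℤ.+ 1) :* c := :- c) ≡.refl c) ∘ IsSquare-* □-1)
    (≡.subst IsSquare (solve 1 (λ c → :- con (ℤ.+ 1) :* (:- c) := c) ≡.refl c) ∘ IsSquare-* □-1)

  4*cardS-□[-1] : IsSquare (- 1#) → 4 ℕ.* cardS F μ ≡ 3 ℕ.* q ℕ.+ 1
  4*cardS-□[-1] □-1 = ℕₚ.+-cancelʳ-≡ (2 ℕ.* isSquare c) _ _
    (≡.trans 4*cardS+2*isSquare-c (≡.cong (λ e → 3 ℕ.* q ℕ.+ 1 ℕ.+ 2 ℕ.* e) (≡.sym (isSquare-c≡isSquare-[-c] □-1))))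

  isSquare-c+isSquare-[-c] : ¬ IsSquare (- 1#) → isSquare c ℕ.+ isSquare (- c) ≡ 1
  isSquare-c+isSquare-[-c] ¬□-1 = begin
    isSquare c ℕ.+ isSquare (- c)        ≡⟨ ≡.cong (λ t → isSquare c ℕ.+ isSquare t) (solve 1 (λ c → :- con (ℤ.+ 1) :* c := :- c) ≡.refl c) ⟨
    isSquare c ℕ.+ isSquare (- 1# * c)   ≡⟨ isSquare+isSquare-ν* c ⟩
    1 ℕ.+ isZero c                       ≡⟨ ≡.cong (1 ℕ.+_) (indicator-no (c ≟ 0#) c≢0) ⟩
    1                                    ∎
    where open NonSquareMultiples F two≢0 ¬□-1 using (isSquare+isSquare-ν*)

  4*cardS-¬□[-1] : ¬ IsSquare (- 1#) → (4 ℕ.* cardS F μ ℕ.+ 1 ≡ 3 ℕ.* q) ⊎ (4 ℕ.* cardS F μ ≡ 3 ℕ.* q ℕ.+ 3)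
  4*cardS-¬□[-1] ¬□-1 = cases-e₊+e₋≡1 (isSquare c) (isSquare (- c)) (isSquare-c+isSquare-[-c] ¬□-1) 4*cardS+2*isSquare-c

open import Data.Nat using (ℕ; _+_; _*_; _^_)
open import Data.Nat.Primality using (Prime)
open import Data.Integer using (+_) renaming (_+_ to _+ℤ_; _-_ to _-ℤ_)
open import Data.Product using (∃; _×_)
open import Data.Sum using (_⊎_)
open import Relation.Nullary using (¬_)
open import Relation.Binary.PropositionalEquality using (_≡_; _≢_)
open FiniteField using (Carrier; q; IsSquare; χ; _-_; -_; 1#)

proposition4p4 : (F : FiniteField) →
    (∃ λ p → ∃ λ n → Prime p × p ≢ 2 × q F ≡ p ^ n) →
    (μ : Carrier F) → ¬ IsSquare F μ →
    ((+ (4 * cardS F μ)) ≡ ((+ (3 * q F + 1) +ℤ χ F (_-_ F μ (1# F))) -ℤ χ F (_-_ F (1# F) μ)))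
    × (IsSquare F (-_ F (1# F)) → 4 * cardS F μ ≡ 3 * q F + 1)
    × (¬ IsSquare F (-_ F (1# F)) → (4 * cardS F μ + 1 ≡ 3 * q F) ⊎ (4 * cardS F μ ≡ 3 * q F + 3))
proposition4p4 F (p , n , p-prime , p≢2 , q≡p^n) μ ¬□μ = 4*cardS≡χ , 4*cardS-□[-1] , 4*cardS-¬□[-1]
  where
  two≢0 : FieldArithmetic.two F ≢ FiniteField.0# F
  two≢0 two≡0 = ¬2∣odd-prime^n n p-prime p≢2 (≡.subst (2 ∣_) q≡p^n (Characteristic.two≡0⇒2∣q F two≡0))
  open Consequences F two≢0 ¬□μ
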